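{- Let $N\ge0$ and $n$ be integers and $b_1,\dots,b_{N+1}$ complex numbers. For all integers $0\leq j\leq N+1$, \[ (1-aq^{2n-1-N})f_{N+1,j,n}(b_1,\ldots,b_{N+1})=(1-b_{N+1}q^n)(1-aq^{2n-1-N-j})f_{N,j,n}(b_1,\ldots,b_N)+(aq^{n-1-N}-b_{N+1})(1-aq^{2n-j})f_{N,j-1,n-1}(b_1,\ldots,b_N), \] where for integers $N'\ge0$, $j',n'$, \[ f_{N',j',n'}(b_1,\ldots,b_{N'})=\sum_{M\in\mathbb{Z}}\sum_{u\in\mathbb{Z}}a^{u}q^{(M-j'+u)(n'-j'+u)+u(n'-N')}\begin{bmatrix}M\\ j'-u\end{bmatrix}\begin{bmatrix}N'-M\\ u\end{bmatrix}(-1)^Me_M(b_1,\dots,b_{N'}). \]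
   Context: $a,q$ are complex numbers. For $k\ge0$, $(q)_k=(q;q)_k=\prod_{i=0}^{k-1}(1-q^{i+1})$... more precisely $(q)_k=\prod_{i=1}^{k}(1-q^{i})$. For integers $N\ge0$ and $j$, the $q$-binomial coefficient is $\begin{bmatrix}N\\ j\end{bmatrix}=\frac{(q)_N}{(q)_j(q)_{N-j}}$ if $0\le j\le N$ and $0$ otherwise. For $0\le M\le N'$, $e_M(X_1,\dots,X_{N'})=\sum_{1\le i_1<\dots<i_M\le N'}X_{i_1}\cdots X_{i_M}$ is the elementary symmetric polynomial, and $e_M=0$ if $M<0$ or $M>N'$ (terms of $f$ with such $M$ are zero). -}

module Defs where

open import Level using (Level)
open import Algebra.Bundles using (CommutativeRing)
open import Data.Nat using (ℕ; zero; suc; _∸_; _≡ᵇ_)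
open import Data.Integer using (ℤ; +_; -[1+_]) renaming (_+_ to _+ℤ_; _-_ to _-ℤ_; _*_ to _*ℤ_)
open import Data.Bool using (Bool; true; false; if_then_else_)
open import Data.List using (List; []; _∷_; _++_; map)
open import Data.Vec using (Vec; []; _∷_)

subsets : (n : ℕ) → List (Vec Bool n)
subsets zero = [] ∷ []
subsets (suc n) = map (true ∷_) (subsets n) ++ map (false ∷_) (subsets n)

card : {n : ℕ} → Vec Bool n → ℕ
card [] = 0
card (true ∷ s) = suc (card s)
card (false ∷ s) = card s

module _ {c ℓ : Level} (R : CommutativeRing c ℓ) where
  open CommutativeRing R

  pow : Carrier → ℕ → Carrier
  pow x zero = 1#
  pow x (suc k) = x * pow x k

  zpow : Carrier → Carrier → ℤ → Carrier
  zpow x xinv (+ k) = pow x k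
  zpow x xinv -[1+ k ] = pow xinv (suc k)

  sumRange : ℕ → (ℕ → Carrier) → Carrier
  sumRange zero g = 0#
  sumRange (suc n) g = sumRange n g + g n

  sumList : List Carrier → Carrier
  sumList [] = 0#
  sumList (x ∷ xs) = x + sumList xs

  prodSub : {n : ℕ} → Vec Bool n → Vec Carrier n → Carrier
  prodSub [] [] = 1#
  prodSub (true ∷ s) (x ∷ xs) = x * prodSub s xs
  prodSub (false ∷ s) (x ∷ xs) = prodSub s xs

  esym : {n : ℕ} → ℕ → Vec Carrier n → Carrier
  esym {n} M xs = sumList (map (λ s → if card s ≡ᵇ M then prodSub s xs else 0#) (subsets n))

  gauss : Carrier → ℕ → ℕ → Carrier
  gauss q zero zero = 1#
  gauss q zero (suc k) = 0#
  gauss q (suc N) zero = 1#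
  gauss q (suc N) (suc k) = gauss q N k + pow q (suc k) * gauss q N (suc k)

  qbin : Carrier → ℕ → ℤ → Carrier
  qbin q N (+ k) = gauss q N k
  qbin q N -[1+ k ] = 0#

  -- f_{N',j',n'}(b_1,…,b_{N'}); the double sum over M,u ∈ ℤ is restricted to
  -- 0 ≤ M ≤ N', 0 ≤ u ≤ N' - M, outside of which the summand vanishes
  -- (e_M = 0 for M ∉ [0,N'], and [N'-M choose u] = 0 for u ∉ [0,N'-M]).
  fpoly : (a q qinv : Carrier) (N' : ℕ) (j' n' : ℤ) → Vec Carrier N' → Carrier
  fpoly a q qinv N' j' n' b =
    sumRange (suc N') λ M →
    sumRange (suc (N' ∸ M)) λ u →
      pow a u
      * zpow q qinv (((+ M -ℤ j') +ℤ + u) *ℤ ((n' -ℤ j') +ℤ + u) +ℤ (+ u) *ℤ (n' -ℤ + N'))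
      * qbin q M (j' -ℤ + u)
      * qbin q (N' ∸ M) (+ u)
      * pow (- 1#) M
      * esym M b

{-# OPTIONS --safe #-}
module Submission where

open import Defs
open import Algebra.Bundles using (CommutativeRing)
import Algebra.Solver.Ring.AlmostCommutativeRing as ACR
open import Data.Bool using (Bool; true; false; if_then_else_)
open import Data.Integer as ℤ using (ℤ; +_; -[1+_]; _⊖_) renaming (_+_ to _+ℤ_; _-_ to _-ℤ_; _*_ to _*ℤ_)
import Data.Integer.Properties as ℤ
open import Data.Integer.Tactic.RingSolver using (solve-∀)
open import Data.List using (List; []; _∷_; _++_; map)
open import Data.List.Properties using (map-++; map-∘)
open import Data.Maybe using (Maybe; just; nothing)
open import Data.Nat as ℕ using (ℕ; zero; suc; _∸_; _≤_; _<_; s≤s)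
import Data.Nat.Properties as ℕ
open import Data.Sum using (inj₁; inj₂)
open import Data.Vec using (Vec; []; _∷_; init; last)
open import Function using (_∘_)
open import Relation.Binary.PropositionalEquality using (_≡_)
import Relation.Binary.PropositionalEquality as ≡
open import Relation.Nullary using (yes; no)

-- Write f_{N′,j,n}(b) = Σ_M (-1)^M e_M(b) F_M(a), where the inner sum F_M over u is a polynomial in a.
-- Since e_M(b₁,…,b_{N+1}) = e_M(b′) + b_{N+1} e_{M-1}(b′), summation by parts in M reduces the claim to
-- two identities for each M (one per power of b_{N+1}) between the polynomials F_M of f_{N+1,j,n},
-- f_{N,j,n} and f_{N,j-1,n-1}. Multiplying by 1 - c a acts on coefficients as X(u) ↦ X(u) - c X(u-1),
-- so it suffices to compare single coefficients q^{…} [M, j-u] [N-M, u]; every such comparison follows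
-- from q-Pascal in one Gaussian binomial and (1 - q^{m-k}) [m, k] = (1 - q^{k+1}) [m, k+1] in the other.

-- The ring solver normalises with coefficients in ℤ, so ℤ is mapped into R.
module IntegerCoefficients {c ℓ} (R : CommutativeRing c ℓ) where
  open CommutativeRing R
  open import Relation.Binary.Reasoning.Setoid setoid
  open import Algebra.Properties.Ring ring using (-‿distribˡ-*; -‿distribʳ-*; -‿involutive; -0#≈0#)
  open import Algebra.Properties.AbelianGroup +-abelianGroup using (⁻¹-∙-comm; xyx⁻¹≈y)
  open import Algebra.Properties.Semiring.Mult.TCOptimised semiring using (_×_; 1+×; ×-homo-+; ×1-homo-*)

  ⟦_⟧ℤ : ℤ → Carrier
  ⟦ + n ⟧ℤ = n × 1#
  ⟦ -[1+ n ] ⟧ℤ = - (suc n × 1#)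

  ⟦⟧-homo-⊖ : ∀ m n → ⟦ m ⊖ n ⟧ℤ ≈ m × 1# - n × 1#
  ⟦⟧-homo-⊖ m zero = sym (trans (+-congˡ -0#≈0#) (+-identityʳ _))
  ⟦⟧-homo-⊖ zero (suc n) = sym (+-identityˡ _)
  ⟦⟧-homo-⊖ (suc m) (suc n) = begin
    ⟦ suc m ⊖ suc n ⟧ℤ                  ≡⟨ ≡.cong ⟦_⟧ℤ (ℤ.[1+m]⊖[1+n]≡m⊖n m n) ⟩
    ⟦ m ⊖ n ⟧ℤ                          ≈⟨ ⟦⟧-homo-⊖ m n ⟩
    m × 1# - n × 1#                     ≈⟨ +-congʳ (xyx⁻¹≈y 1# (m × 1#)) ⟨
    ((1# + m × 1#) - 1#) - n × 1#       ≈⟨ +-assoc _ _ _ ⟩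
    (1# + m × 1#) + (- 1# - n × 1#)     ≈⟨ +-congˡ (⁻¹-∙-comm 1# (n × 1#)) ⟩
    (1# + m × 1#) - (1# + n × 1#)       ≈⟨ +-cong (1+× m 1#) (-‿cong (1+× n 1#)) ⟨
    suc m × 1# - suc n × 1#             ∎

  ⟦⟧-homo-+ : ∀ i j → ⟦ i ℤ.+ j ⟧ℤ ≈ ⟦ i ⟧ℤ + ⟦ j ⟧ℤ
  ⟦⟧-homo-+ (+ m) (+ n) = ×-homo-+ 1# m n
  ⟦⟧-homo-+ (+ m) -[1+ n ] = ⟦⟧-homo-⊖ m (suc n)
  ⟦⟧-homo-+ -[1+ m ] (+ n) = trans (⟦⟧-homo-⊖ n (suc m)) (+-comm _ _)
  ⟦⟧-homo-+ -[1+ m ] -[1+ n ] = begin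
    - (suc (suc (m ℕ.+ n)) × 1#)        ≡⟨ ≡.cong (λ k → - (suc k × 1#)) (ℕ.+-suc m n) ⟨
    - ((suc m ℕ.+ suc n) × 1#)          ≈⟨ -‿cong (×-homo-+ 1# (suc m) (suc n)) ⟩
    - (suc m × 1# + suc n × 1#)         ≈⟨ ⁻¹-∙-comm _ _ ⟨
    - (suc m × 1#) - suc n × 1#         ∎

  ⟦⟧-homo-neg : ∀ i → ⟦ ℤ.- i ⟧ℤ ≈ - ⟦ i ⟧ℤ
  ⟦⟧-homo-neg (+ zero) = sym -0#≈0#
  ⟦⟧-homo-neg (+ suc n) = refl
  ⟦⟧-homo-neg -[1+ n ] = sym (-‿involutive _)

  ⟦⟧-homo-*-+ : ∀ m j → ⟦ + m ℤ.* j ⟧ℤ ≈ ⟦ + m ⟧ℤ * ⟦ j ⟧ℤ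
  ⟦⟧-homo-*-+ m (+ n) = trans (reflexive (≡.cong ⟦_⟧ℤ (≡.sym (ℤ.pos-* m n)))) (×1-homo-* m n)
  ⟦⟧-homo-*-+ m -[1+ n ] = begin
    ⟦ + m ℤ.* -[1+ n ] ⟧ℤ               ≡⟨ ≡.cong ⟦_⟧ℤ (ℤ.neg-distribʳ-* (+ m) (+ suc n)) ⟨
    ⟦ ℤ.- (+ m ℤ.* + suc n) ⟧ℤ          ≈⟨ ⟦⟧-homo-neg (+ m ℤ.* + suc n) ⟩
    - ⟦ + m ℤ.* + suc n ⟧ℤ              ≈⟨ -‿cong (⟦⟧-homo-*-+ m (+ suc n)) ⟩
    - (m × 1# * suc n × 1#)             ≈⟨ -‿distribʳ-* _ _ ⟩
    m × 1# * - (suc n × 1#)             ∎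

  ⟦⟧-homo-* : ∀ i j → ⟦ i ℤ.* j ⟧ℤ ≈ ⟦ i ⟧ℤ * ⟦ j ⟧ℤ
  ⟦⟧-homo-* (+ m) j = ⟦⟧-homo-*-+ m j
  ⟦⟧-homo-* -[1+ m ] j = begin
    ⟦ -[1+ m ] ℤ.* j ⟧ℤ                 ≡⟨ ≡.cong ⟦_⟧ℤ (ℤ.neg-distribˡ-* (+ suc m) j) ⟨
    ⟦ ℤ.- (+ suc m ℤ.* j) ⟧ℤ            ≈⟨ ⟦⟧-homo-neg (+ suc m ℤ.* j) ⟩
    - ⟦ + suc m ℤ.* j ⟧ℤ                ≈⟨ -‿cong (⟦⟧-homo-*-+ (suc m) j) ⟩
    - (suc m × 1# * ⟦ j ⟧ℤ)             ≈⟨ -‿distribˡ-* _ _ ⟩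
    - (suc m × 1#) * ⟦ j ⟧ℤ             ∎

  ⟦⟧-morphism : ACR._-Raw-AlmostCommutative⟶_ (CommutativeRing.rawRing ℤ.+-*-commutativeRing)
                                              (ACR.fromCommutativeRing R)
  ⟦⟧-morphism = record
    { ⟦_⟧ = ⟦_⟧ℤ ; +-homo = ⟦⟧-homo-+ ; *-homo = ⟦⟧-homo-* ; -‿homo = ⟦⟧-homo-neg
    ; 0-homo = refl ; 1-homo = refl }

  ⟦⟧-equal? : ∀ i j → Maybe (⟦ i ⟧ℤ ≈ ⟦ j ⟧ℤ)
  ⟦⟧-equal? i j with i ℤ.≟ j
  ... | yes ≡.refl = just refl
  ... | no _ = nothing

  open import Algebra.Solver.Ring (CommutativeRing.rawRing ℤ.+-*-commutativeRing)
    (ACR.fromCommutativeRing R) ⟦⟧-morphism ⟦⟧-equal? public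

-- INLINE lets the integer ring solver see the polynomial behind exponent.
exponent : ℤ → ℤ → ℤ → ℤ → ℤ → ℤ
exponent N M j n z = ((M -ℤ j) +ℤ z) *ℤ ((n -ℤ j) +ℤ z) +ℤ z *ℤ (n -ℤ N)
{-# INLINE exponent #-}

module _ {c ℓ} (R : CommutativeRing c ℓ) where
  open CommutativeRing R
  open import Relation.Binary.Reasoning.Setoid setoid
  open IntegerCoefficients R
  open import Algebra.Properties.Ring ring using (-‿distribˡ-*; -0#≈0#)

  sumRange-cong : ∀ n {f g} → (∀ i → i < n → f i ≈ g i) → sumRange R n f ≈ sumRange R n g
  sumRange-cong zero f≈g = refl
  sumRange-cong (suc n) f≈g = +-cong (sumRange-cong n (λ i i<n → f≈g i (ℕ.m<n⇒m<1+n i<n))) (f≈g n ℕ.≤-refl)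

  sumRange-+ : ∀ n f g → sumRange R n (λ i → f i + g i) ≈ sumRange R n f + sumRange R n g
  sumRange-+ zero f g = sym (+-identityʳ 0#)
  sumRange-+ (suc n) f g = trans (+-congʳ (sumRange-+ n f g))
    (solve 4 (λ x y u v → (x :+ y) :+ (u :+ v) := (x :+ u) :+ (y :+ v)) refl _ _ (f n) (g n))

  sumRange-distribˡ : ∀ n x f → sumRange R n (λ i → x * f i) ≈ x * sumRange R n f
  sumRange-distribˡ zero x f = sym (zeroʳ x)
  sumRange-distribˡ (suc n) x f = trans (+-congʳ (sumRange-distribˡ n x f)) (sym (distribˡ x _ _))

  sumRange-distribʳ : ∀ n x f → sumRange R n (λ i → f i * x) ≈ sumRange R n f * x
  sumRange-distribʳ zero x f = sym (zeroˡ x)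
  sumRange-distribʳ (suc n) x f = trans (+-congʳ (sumRange-distribʳ n x f)) (sym (distribʳ x _ _))

  summation-by-parts : ∀ K (F E E′ : ℕ → Carrier) x → E 0 ≈ E′ 0 →
    (∀ M → E (suc M) ≈ E′ (suc M) - x * E′ M) →
    sumRange R (suc K) (λ M → F M * E M) ≈ sumRange R K (λ M → (F M - x * F (suc M)) * E′ M) + F K * E′ K
  summation-by-parts zero F E E′ x E₀ Eₛ = +-congˡ (*-congˡ E₀)
  summation-by-parts (suc K) F E E′ x E₀ Eₛ = begin
    sumRange R (suc K) (λ M → F M * E M) + F (suc K) * E (suc K)
      ≈⟨ +-cong (summation-by-parts K F E E′ x E₀ Eₛ) (*-congˡ (Eₛ K)) ⟩
    (S + F K * E′ K) + F (suc K) * (E′ (suc K) - x * E′ K)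
      ≈⟨ solve 6 (λ S f e f′ e′ x → (S :+ f :* e) :+ f′ :* (e′ :- x :* e) := (S :+ (f :- x :* f′) :* e) :+ f′ :* e′)
               refl S (F K) (E′ K) (F (suc K)) (E′ (suc K)) x ⟩
    (S + (F K - x * F (suc K)) * E′ K) + F (suc K) * E′ (suc K) ∎
    where S = sumRange R K (λ M → (F M - x * F (suc M)) * E′ M)

  sumList-++ : ∀ xs ys → sumList R (xs ++ ys) ≈ sumList R xs + sumList R ys
  sumList-++ [] ys = sym (+-identityˡ _)
  sumList-++ (x ∷ xs) ys = trans (+-congˡ (sumList-++ xs ys)) (sym (+-assoc _ _ _))

  sumList-cong : ∀ {A : Set} {f g : A → Carrier} xs → (∀ s → f s ≈ g s) → sumList R (map f xs) ≈ sumList R (map g xs)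
  sumList-cong [] f≈g = refl
  sumList-cong (x ∷ xs) f≈g = +-cong (f≈g x) (sumList-cong xs f≈g)

  sumList-distribˡ : ∀ {A : Set} x (f : A → Carrier) xs → sumList R (map (λ s → x * f s) xs) ≈ x * sumList R (map f xs)
  sumList-distribˡ x f [] = sym (zeroʳ x)
  sumList-distribˡ x f (s ∷ xs) = trans (+-congˡ (sumList-distribˡ x f xs)) (sym (distribˡ x _ _))

  sumList-zero : ∀ {A : Set} (xs : List A) → sumList R (map (λ _ → 0#) xs) ≈ 0#
  sumList-zero [] = refl
  sumList-zero (x ∷ xs) = trans (+-identityˡ _) (sumList-zero xs)

  private
    subsetTerm : ∀ {n} → ℕ → Vec Carrier n → Vec Bool n → Carrier
    subsetTerm M xs s = if card s ℕ.≡ᵇ M then prodSub R s xs else 0#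

  esym-cons : ∀ {n} M x (xs : Vec Carrier n) →
    esym R M (x ∷ xs) ≈ sumList R (map (λ s → subsetTerm M (x ∷ xs) (true ∷ s)) (subsets n)) + esym R M xs
  esym-cons {n} M x xs = begin
    sumList R (map t (map (true ∷_) S ++ map (false ∷_) S))
      ≡⟨ ≡.cong (sumList R) (map-++ t (map (true ∷_) S) (map (false ∷_) S)) ⟩
    sumList R (map t (map (true ∷_) S) ++ map t (map (false ∷_) S))
      ≈⟨ sumList-++ (map t (map (true ∷_) S)) (map t (map (false ∷_) S)) ⟩
    sumList R (map t (map (true ∷_) S)) + sumList R (map t (map (false ∷_) S))
      ≡⟨ ≡.cong₂ (λ u v → sumList R u + sumList R v) (≡.sym (map-∘ S)) (≡.sym (map-∘ S)) ⟩
    sumList R (map (t ∘ (true ∷_)) S) + esym R M xs ∎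
    where
    S = subsets n
    t = subsetTerm M (x ∷ xs)

  esym-zero : ∀ {n} (xs : Vec Carrier n) → esym R 0 xs ≈ 1#
  esym-zero [] = +-identityʳ 1#
  esym-zero {suc n} (x ∷ xs) = trans (esym-cons 0 x xs) (trans (+-congʳ (sumList-zero (subsets n))) (trans (+-identityˡ _) (esym-zero xs)))

  esym-cons-suc : ∀ {n} M x (xs : Vec Carrier n) → esym R (suc M) (x ∷ xs) ≈ x * esym R M xs + esym R (suc M) xs
  esym-cons-suc {n} M x xs = trans (esym-cons (suc M) x xs)
    (+-congʳ (trans (sumList-cong (subsets n) (λ s → if-distrib (card s ℕ.≡ᵇ M) (prodSub R s xs)))
                    (sumList-distribˡ x (subsetTerm M xs) (subsets n))))
    where
    if-distrib : ∀ b y → (if b then x * y else 0#) ≈ x * (if b then y else 0#)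
    if-distrib true y = refl
    if-distrib false y = sym (zeroʳ x)

  esym-vanish : ∀ {n} (xs : Vec Carrier n) M → n < M → esym R M xs ≈ 0#
  esym-vanish [] (suc M) _ = +-identityʳ 0#
  esym-vanish (x ∷ xs) (suc M) (s≤s n<M) = begin
    esym R (suc M) (x ∷ xs)               ≈⟨ esym-cons-suc M x xs ⟩
    x * esym R M xs + esym R (suc M) xs   ≈⟨ +-cong (*-congˡ (esym-vanish xs M n<M)) (esym-vanish xs (suc M) (ℕ.m<n⇒m<1+n n<M)) ⟩
    x * 0# + 0#                           ≈⟨ trans (+-identityʳ _) (zeroʳ x) ⟩
    0#                                    ∎

  esym-snoc : ∀ N (b : Vec Carrier (suc N)) M → esym R (suc M) b ≈ esym R (suc M) (init b) + last b * esym R M (init b)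
  esym-snoc zero (x ∷ []) M = trans (esym-cons-suc M x []) (+-comm _ _)
  esym-snoc (suc N) (x ∷ b) zero = begin
    esym R 1 (x ∷ b)                 ≈⟨ esym-cons-suc 0 x b ⟩
    x * esym R 0 b + esym R 1 b      ≈⟨ +-cong (*-congˡ (esym-zero≈ b b′)) (esym-snoc N b 0) ⟩
    x * e₀ + (e₁ + l * e₀)           ≈⟨ solve 4 (λ x e₀ e₁ l → x :* e₀ :+ (e₁ :+ l :* e₀) := (x :* e₀ :+ e₁) :+ l :* e₀) refl x e₀ e₁ l ⟩
    (x * e₀ + e₁) + l * e₀           ≈⟨ +-cong (esym-cons-suc 0 x b′) (*-congˡ (esym-zero≈ (x ∷ b′) b′)) ⟨
    esym R 1 (x ∷ b′) + l * esym R 0 (x ∷ b′) ∎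
    where
    b′ = init b
    l = last b
    e₀ = esym R 0 b′
    e₁ = esym R 1 b′
    esym-zero≈ : ∀ {m n} (xs : Vec Carrier m) (ys : Vec Carrier n) → esym R 0 xs ≈ esym R 0 ys
    esym-zero≈ xs ys = trans (esym-zero xs) (sym (esym-zero ys))
  esym-snoc (suc N) (x ∷ b) (suc M) = begin
    esym R (suc (suc M)) (x ∷ b)
      ≈⟨ esym-cons-suc (suc M) x b ⟩
    x * esym R (suc M) b + esym R (suc (suc M)) b
      ≈⟨ +-cong (*-congˡ (esym-snoc N b M)) (esym-snoc N b (suc M)) ⟩
    x * (e₁ + l * e₀) + (e₂ + l * e₁)
      ≈⟨ solve 5 (λ x e₀ e₁ e₂ l → x :* (e₁ :+ l :* e₀) :+ (e₂ :+ l :* e₁) := (x :* e₁ :+ e₂) :+ l :* (x :* e₀ :+ e₁)) refl x e₀ e₁ e₂ l ⟩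
    (x * e₁ + e₂) + l * (x * e₀ + e₁)
      ≈⟨ +-cong (esym-cons-suc (suc M) x b′) (*-congˡ (esym-cons-suc M x b′)) ⟨
    esym R (suc (suc M)) (x ∷ b′) + l * esym R (suc M) (x ∷ b′) ∎
    where
    b′ = init b
    l = last b
    e₀ = esym R M b′
    e₁ = esym R (suc M) b′
    e₂ = esym R (suc (suc M)) b′

  pow-+ : ∀ x m n → pow R x (m ℕ.+ n) ≈ pow R x m * pow R x n
  pow-+ x zero n = sym (*-identityˡ _)
  pow-+ x (suc m) n = trans (*-congˡ (pow-+ x m n)) (sym (*-assoc _ _ _))

  module Series (a : Carrier) where

    series : (ℤ → Carrier) → ℕ → Carrier
    series X L = sumRange R L (λ u → pow R a u * X (+ u))

    series-cong : ∀ L {X Y : ℤ → Carrier} → (∀ z → X z ≈ Y z) → series X L ≈ series Y L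
    series-cong L X≈Y = sumRange-cong L (λ u _ → *-congˡ (X≈Y (+ u)))

    series-+ : ∀ L (X Y : ℤ → Carrier) → series (λ z → X z + Y z) L ≈ series X L + series Y L
    series-+ L X Y = trans (sumRange-cong L (λ u _ → distribˡ _ _ _)) (sumRange-+ L _ _)

    series-scale : ∀ L x (X : ℤ → Carrier) → series (λ z → x * X z) L ≈ x * series X L
    series-scale L x X = trans (sumRange-cong L (λ u _ → x-comm u)) (sumRange-distribˡ L x _)
      where
      x-comm : ∀ u → pow R a u * (x * X (+ u)) ≈ x * (pow R a u * X (+ u))
      x-comm u = solve 3 (λ p x y → p :* (x :* y) := x :* (p :* y)) refl (pow R a u) x (X (+ u))

    series-extend : ∀ X L → X (+ L) ≈ 0# → series X (suc L) ≈ series X L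
    series-extend X L X≈0 = trans (+-congˡ (trans (*-congˡ X≈0) (zeroʳ _))) (+-identityʳ _)

    series-pad : ∀ X {K} L → (∀ u → K ≤ u → X (+ u) ≈ 0#) → K ≤ L → series X L ≈ series X K
    series-pad X {K} L vanish K≤L with ℕ.m≤n⇒m<n∨m≡n K≤L
    ... | inj₂ ≡.refl = refl
    series-pad X {K} (suc L) vanish _ | inj₁ (s≤s K≤L) =
      trans (series-extend X L (vanish L K≤L)) (series-pad X L vanish K≤L)

    series-shift : ∀ X L → X -[1+ 0 ] ≈ 0# → series (λ z → X (z -ℤ + 1)) (suc L) ≈ a * series X L
    series-shift X zero X₋₁≈0 = trans (+-identityˡ _) (trans (*-congˡ X₋₁≈0) (trans (zeroʳ _) (sym (zeroʳ a))))
    series-shift X (suc L) X₋₁≈0 = begin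
      series (λ z → X (z -ℤ + 1)) (suc L) + pow R a (suc L) * X (+ L)
        ≈⟨ +-congʳ (series-shift X L X₋₁≈0) ⟩
      a * series X L + (a * pow R a L) * X (+ L)
        ≈⟨ solve 4 (λ a s p x → a :* s :+ (a :* p) :* x := a :* (s :+ p :* x)) refl a (series X L) (pow R a L) (X (+ L)) ⟩
      a * series X (suc L) ∎

    series-mul-a : ∀ X L → X -[1+ 0 ] ≈ 0# → X (+ L) ≈ 0# →
                   a * series X (suc L) ≈ series (λ z → X (z -ℤ + 1)) (suc L)
    series-mul-a X L X₋₁≈0 X≈0 = trans (*-congˡ (series-extend X L X≈0)) (sym (series-shift X L X₋₁≈0))

    series-mul-1-ac : ∀ X L x → X -[1+ 0 ] ≈ 0# → X (+ L) ≈ 0# →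
                      (1# - a * x) * series X (suc L) ≈ series (λ z → X z - x * X (z -ℤ + 1)) (suc L)
    series-mul-1-ac X L x X₋₁≈0 X≈0 = begin
      (1# - a * x) * series X (suc L)
        ≈⟨ solve 3 (λ a x s → (con (+ 1) :- a :* x) :* s := s :+ (:- x) :* (a :* s)) refl a x (series X (suc L)) ⟩
      series X (suc L) + (- x) * (a * series X (suc L))
        ≈⟨ +-congˡ (*-congˡ (series-mul-a X L X₋₁≈0 X≈0)) ⟩
      series X (suc L) + (- x) * series X₋ (suc L)
        ≈⟨ +-congˡ (series-scale (suc L) (- x) X₋) ⟨
      series X (suc L) + series (λ z → (- x) * X₋ z) (suc L)
        ≈⟨ series-+ (suc L) X (λ z → (- x) * X₋ z) ⟨
      series (λ z → X z + (- x) * X₋ z) (suc L)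
        ≈⟨ series-cong (suc L) (λ z → +-congˡ {X z} (sym (-‿distribˡ-* x (X₋ z)))) ⟩
      series (λ z → X z - x * X₋ z) (suc L) ∎
      where X₋ = λ z → X (z -ℤ + 1)

  module _ (q qinv : Carrier) (q*qinv≈1 : q * qinv ≈ 1#) where

    Q : ℤ → Carrier
    Q = zpow R q qinv

    Q-⊖ : ∀ m k → Q (m ⊖ k) ≈ pow R q m * pow R qinv k
    Q-⊖ m zero = sym (*-identityʳ _)
    Q-⊖ zero (suc k) = sym (*-identityˡ _)
    Q-⊖ (suc m) (suc k) = begin
      Q (suc m ⊖ suc k)                       ≡⟨ ≡.cong Q (ℤ.[1+m]⊖[1+n]≡m⊖n m k) ⟩
      Q (m ⊖ k)                               ≈⟨ Q-⊖ m k ⟩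
      pow R q m * pow R qinv k                ≈⟨ *-identityˡ _ ⟨
      1# * (pow R q m * pow R qinv k)         ≈⟨ *-congʳ q*qinv≈1 ⟨
      (q * qinv) * (pow R q m * pow R qinv k) ≈⟨ solve 4 (λ q q′ x y → (q :* q′) :* (x :* y) := (q :* x) :* (q′ :* y)) refl q qinv _ _ ⟩
      pow R q (suc m) * pow R qinv (suc k)    ∎

    Q-+ : ∀ x y → Q (x +ℤ y) ≈ Q x * Q y
    Q-+ (+ m) (+ n) = pow-+ q m n
    Q-+ (+ m) -[1+ n ] = Q-⊖ m (suc n)
    Q-+ -[1+ m ] (+ n) = trans (Q-⊖ n (suc m)) (*-comm _ _)
    Q-+ -[1+ m ] -[1+ n ] = trans (reflexive (≡.cong (λ k → pow R qinv (suc k)) (≡.sym (ℕ.+-suc m n))))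
                                  (pow-+ qinv (suc m) (suc n))

    Q-merge : ∀ x y {z} → x +ℤ y ≡ z → Q x * Q y ≈ Q z
    Q-merge x y ≡.refl = sym (Q-+ x y)

    Q-merge₃ : ∀ x y w {z} → x +ℤ (y +ℤ w) ≡ z → Q x * (Q y * Q w) ≈ Q z
    Q-merge₃ x y w e = trans (*-congˡ (Q-merge y w ≡.refl)) (Q-merge x (y +ℤ w) e)

    Q-regroup : ∀ x y x′ y′ → x +ℤ y ≡ x′ +ℤ y′ → Q x * Q y ≈ Q x′ * Q y′
    Q-regroup x y x′ y′ e = trans (Q-merge x y e) (sym (Q-merge x′ y′ ≡.refl))

    G : ℕ → ℤ → Carrier
    G = qbin R q

    gauss-zero : ∀ m → gauss R q m 0 ≡ 1#
    gauss-zero zero = ≡.refl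
    gauss-zero (suc m) = ≡.refl

    gauss-vanish : ∀ {m k} → m < k → gauss R q m k ≈ 0#
    gauss-vanish {zero} {suc k} _ = refl
    gauss-vanish {suc m} {suc k} (s≤s m<k) = begin
      gauss R q m k + pow R q (suc k) * gauss R q m (suc k) ≈⟨ +-cong (gauss-vanish m<k) (*-congˡ (gauss-vanish (ℕ.m<n⇒m<1+n m<k))) ⟩
      0# + pow R q (suc k) * 0#                             ≈⟨ trans (+-identityˡ _) (zeroʳ _) ⟩
      0#                                                    ∎

    qbin-pascal : ∀ m z → G (suc m) z ≈ G m (z -ℤ + 1) + Q z * G m z
    qbin-pascal m (+ zero) = sym (trans (+-identityˡ _) (trans (*-identityˡ _) (reflexive (gauss-zero m))))
    qbin-pascal m (+ suc k) = refl
    qbin-pascal m -[1+ k ] = sym (trans (+-identityˡ _) (zeroʳ _))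

    qbin-ratio : ∀ m k → (1# - Q (+ m -ℤ k)) * G m k ≈ (1# - Q (k +ℤ + 1)) * G m (k +ℤ + 1)
    qbin-ratio zero (+ zero) = trans (*-congʳ (-‿inverseʳ 1#)) (trans (zeroˡ _) (sym (zeroʳ _)))
    qbin-ratio zero (+ suc k) = trans (zeroʳ _) (sym (zeroʳ _))
    qbin-ratio zero -[1+ zero ] = trans (zeroʳ _) (sym (trans (*-congʳ (-‿inverseʳ 1#)) (zeroˡ _)))
    qbin-ratio zero -[1+ suc k ] = trans (zeroʳ _) (sym (zeroʳ _))
    qbin-ratio (suc m) k = trans lhs≈ (sym rhs≈)
      where
      lower : ∀ m k → (+ 1 +ℤ m) -ℤ k ≡ m -ℤ (k -ℤ + 1)
      lower = solve-∀
      raise : ∀ k → (k -ℤ + 1) +ℤ + 1 ≡ k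
      raise = solve-∀
      lower′ : ∀ k → (k +ℤ + 1) -ℤ + 1 ≡ k
      lower′ = solve-∀
      split : ∀ m k → k +ℤ ((+ 1 +ℤ m) -ℤ k) ≡ + 1 +ℤ m
      split = solve-∀
      split′ : ∀ m k → (k +ℤ + 1) +ℤ (m -ℤ k) ≡ + 1 +ℤ m
      split′ = solve-∀

      ratio-below : (1# - Q (+ suc m -ℤ k)) * G m (k -ℤ + 1) ≈ (1# - Q k) * G m k
      ratio-below = begin
        (1# - Q (+ suc m -ℤ k)) * G m (k -ℤ + 1)
          ≡⟨ ≡.cong (λ e → (1# - Q e) * G m (k -ℤ + 1)) (lower (+ m) k) ⟩
        (1# - Q (+ m -ℤ (k -ℤ + 1))) * G m (k -ℤ + 1)
          ≈⟨ qbin-ratio m (k -ℤ + 1) ⟩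
        (1# - Q ((k -ℤ + 1) +ℤ + 1)) * G m ((k -ℤ + 1) +ℤ + 1)
          ≡⟨ ≡.cong (λ e → (1# - Q e) * G m e) (raise k) ⟩
        (1# - Q k) * G m k ∎

      lhs≈ : (1# - Q (+ suc m -ℤ k)) * G (suc m) k ≈ (1# - Q (+ suc m)) * G m k
      lhs≈ = begin
        (1# - Q (+ suc m -ℤ k)) * G (suc m) k
          ≈⟨ *-congˡ (qbin-pascal m k) ⟩
        (1# - Q s) * (G m (k -ℤ + 1) + Q k * G m k)
          ≈⟨ solve 4 (λ x g y h → (con (+ 1) :- x) :* (g :+ y :* h) := (con (+ 1) :- x) :* g :+ (y :- y :* x) :* h) refl (Q s) _ (Q k) _ ⟩
        (1# - Q s) * G m (k -ℤ + 1) + (Q k - Q k * Q s) * G m k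
          ≈⟨ +-cong ratio-below (*-congʳ (+-congˡ (-‿cong (Q-merge k s (split (+ m) k))))) ⟩
        (1# - Q k) * G m k + (Q k - Q (+ suc m)) * G m k
          ≈⟨ solve 3 (λ x y h → (con (+ 1) :- x) :* h :+ (x :- y) :* h := (con (+ 1) :- y) :* h) refl (Q k) _ _ ⟩
        (1# - Q (+ suc m)) * G m k ∎
        where s = + suc m -ℤ k

      rhs≈ : (1# - Q (k +ℤ + 1)) * G (suc m) (k +ℤ + 1) ≈ (1# - Q (+ suc m)) * G m k
      rhs≈ = begin
        (1# - Q k₁) * G (suc m) k₁
          ≈⟨ *-congˡ (qbin-pascal m k₁) ⟩
        (1# - Q k₁) * (G m (k₁ -ℤ + 1) + Q k₁ * G m k₁)
          ≡⟨ ≡.cong (λ e → (1# - Q k₁) * (G m e + Q k₁ * G m k₁)) (lower′ k) ⟩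
        (1# - Q k₁) * (G m k + Q k₁ * G m k₁)
          ≈⟨ solve 3 (λ y g h → (con (+ 1) :- y) :* (g :+ y :* h) := (con (+ 1) :- y) :* g :+ y :* ((con (+ 1) :- y) :* h)) refl (Q k₁) _ _ ⟩
        (1# - Q k₁) * G m k + Q k₁ * ((1# - Q k₁) * G m k₁)
          ≈⟨ +-congˡ (*-congˡ (qbin-ratio m k)) ⟨
        (1# - Q k₁) * G m k + Q k₁ * ((1# - Q (+ m -ℤ k)) * G m k)
          ≈⟨ solve 3 (λ y x g → (con (+ 1) :- y) :* g :+ y :* ((con (+ 1) :- x) :* g) := (con (+ 1) :- y :* x) :* g) refl (Q k₁) (Q (+ m -ℤ k)) _ ⟩
        (1# - Q k₁ * Q (+ m -ℤ k)) * G m k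
          ≈⟨ *-congʳ (+-congˡ (-‿cong (Q-merge k₁ (+ m -ℤ k) (split′ (+ m) k)))) ⟩
        (1# - Q (+ suc m)) * G m k ∎
        where k₁ = k +ℤ + 1

    module _ (a : Carrier) where
      open Series a

      coef : ℕ → ℤ → ℤ → ℕ → ℤ → Carrier
      coef N j n M z = Q (exponent (+ N) (+ M) j n z) * G M (j -ℤ z) * G (N ∸ M) z

      coef-negative : ∀ N j n M k → coef N j n M -[1+ k ] ≈ 0#
      coef-negative N j n M k = zeroʳ _

      coef-vanish : ∀ N j n M u → N ∸ M < u → coef N j n M (+ u) ≈ 0#
      coef-vanish N j n M u N-M<u = trans (*-congˡ (gauss-vanish N-M<u)) (zeroʳ _)

      fpoly-as-series : ∀ N j n (b : Vec Carrier N) L → N < L →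
        fpoly R a q qinv N j n b ≈ sumRange R (suc N) (λ M → series (coef N j n M) L * (pow R (- 1#) M * esym R M b))
      fpoly-as-series N j n b L N<L = sumRange-cong (suc N) λ M _ → begin
        sumRange R (suc (N ∸ M)) (λ u → pow R a u * Q (exponent (+ N) (+ M) j n (+ u)) * G M (j -ℤ + u) * G (N ∸ M) (+ u) * s M * esym R M b)
          ≈⟨ sumRange-cong (suc (N ∸ M)) (λ u _ → solve 6 (λ p e g h s x → p :* e :* g :* h :* s :* x := (p :* (e :* g :* h)) :* (s :* x)) refl
                 (pow R a u) (Q (exponent (+ N) (+ M) j n (+ u))) (G M (j -ℤ + u)) (G (N ∸ M) (+ u)) (s M) (esym R M b)) ⟩
        sumRange R (suc (N ∸ M)) (λ u → pow R a u * coef N j n M (+ u) * (s M * esym R M b))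
          ≈⟨ sumRange-distribʳ (suc (N ∸ M)) _ _ ⟩
        series (coef N j n M) (suc (N ∸ M)) * (s M * esym R M b)
          ≈⟨ *-congʳ (series-pad (coef N j n M) L (coef-vanish N j n M) (ℕ.<-≤-trans (s≤s (ℕ.m∸n≤m N M)) N<L)) ⟨
        series (coef N j n M) L * (s M * esym R M b) ∎
        where s = pow R (- 1#)

      module Contiguity (N M : ℕ) (M≤N : M ≤ N) (j n : ℤ) where

        A A′ B C : ℤ → Carrier
        A = coef (suc N) j n M
        A′ = coef (suc N) j n (suc M)
        B = coef N j n M
        C = coef N (j -ℤ + 1) (n -ℤ + 1) M

        K : ℕ
        K = N ∸ M

        K≡N-M : + K ≡ + N -ℤ + M
        K≡N-M = ≡.sym (≡.trans (ℤ.m-n≡m⊖n N M) (ℤ.⊖-≥ M≤N))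

        Q₁ Q₂ Q₃ Q₄ : Carrier
        Q₁ = Q (+ 2 *ℤ n -ℤ + 1 -ℤ + N)
        Q₂ = Q (+ 2 *ℤ n -ℤ + 1 -ℤ + N -ℤ j)
        Q₃ = Q (n -ℤ + 1 -ℤ + N)
        Q₄ = Q (+ 2 *ℤ n -ℤ j)

        Qs : ℤ → Carrier
        Qs z = Q (+ M -ℤ (j -ℤ z))

        A-pascal : ∀ z → A z ≈ B z + Q₃ * (Qs z * C (z -ℤ + 1))
        A-pascal z = begin
          Q eA * g * G (suc N ∸ M) z
            ≡⟨ ≡.cong (λ k → Q eA * g * G k z) (ℕ.+-∸-assoc 1 M≤N) ⟩
          Q eA * g * G (suc K) z
            ≈⟨ *-congˡ (qbin-pascal K z) ⟩
          Q eA * g * (G K (z -ℤ + 1) + Q z * G K z)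
            ≈⟨ solve 5 (λ e g h₁ y h → e :* g :* (h₁ :+ y :* h) := (e :* y) :* g :* h :+ e :* g :* h₁) refl (Q eA) g _ (Q z) _ ⟩
          (Q eA * Q z) * g * G K z + Q eA * g * G K (z -ℤ + 1)
            ≈⟨ +-cong (*-congʳ (*-congʳ (Q-merge eA z (shift-z (+ M) (+ N) j n z))))
                      (*-congʳ (*-congʳ (sym (Q-merge₃ (n -ℤ + 1 -ℤ + N) (+ M -ℤ (j -ℤ z)) eC (split (+ M) (+ N) j n z))))) ⟩
          Q eB * g * G K z + (Q₃ * (Qs z * Q eC)) * g * G K (z -ℤ + 1)
            ≡⟨ ≡.cong (λ i → Q eB * g * G K z + (Q₃ * (Qs z * Q eC)) * G M i * G K (z -ℤ + 1)) (≡.sym (index j z)) ⟩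
          B z + (Q₃ * (Qs z * Q eC)) * G M ((j -ℤ + 1) -ℤ (z -ℤ + 1)) * G K (z -ℤ + 1)
            ≈⟨ +-congˡ (solve 5 (λ x y e g h → (x :* (y :* e)) :* g :* h := x :* (y :* (e :* g :* h))) refl Q₃ (Qs z) (Q eC) _ _) ⟩
          B z + Q₃ * (Qs z * C (z -ℤ + 1)) ∎
          where
          eA = exponent (+ suc N) (+ M) j n z
          eB = exponent (+ N) (+ M) j n z
          eC = exponent (+ N) (+ M) (j -ℤ + 1) (n -ℤ + 1) (z -ℤ + 1)
          g = G M (j -ℤ z)
          shift-z : ∀ m N j n z → exponent (+ 1 +ℤ N) m j n z +ℤ z ≡ exponent N m j n z
          shift-z = solve-∀
          split : ∀ m N j n z → (n -ℤ + 1 -ℤ N) +ℤ ((m -ℤ (j -ℤ z)) +ℤ exponent N m (j -ℤ + 1) (n -ℤ + 1) (z -ℤ + 1))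
                                ≡ exponent (+ 1 +ℤ N) m j n z
          split = solve-∀
          index : ∀ j z → (j -ℤ + 1) -ℤ (z -ℤ + 1) ≡ j -ℤ z
          index = solve-∀

        A′-pascal : ∀ z → A′ z ≈ C z + Q (n -ℤ z) * B z
        A′-pascal z = begin
          Q eA′ * G (suc M) (j -ℤ z) * h
            ≈⟨ *-congʳ (*-congˡ (qbin-pascal M (j -ℤ z))) ⟩
          Q eA′ * (G M ((j -ℤ z) -ℤ + 1) + Q (j -ℤ z) * g) * h
            ≈⟨ solve 5 (λ e g′ y g h → e :* (g′ :+ y :* g) :* h := e :* g′ :* h :+ (e :* y) :* g :* h) refl (Q eA′) _ (Q (j -ℤ z)) g h ⟩
          Q eA′ * G M ((j -ℤ z) -ℤ + 1) * h + (Q eA′ * Q (j -ℤ z)) * g * h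
            ≡⟨ ≡.cong₂ (λ e i → Q e * G M i * h + (Q eA′ * Q (j -ℤ z)) * g * h) (same-exponent (+ M) (+ N) j n z) (index j z) ⟩
          C z + (Q eA′ * Q (j -ℤ z)) * g * h
            ≈⟨ +-congˡ (*-congʳ (*-congʳ (Q-regroup eA′ (j -ℤ z) (n -ℤ z) eB (split (+ M) (+ N) j n z)))) ⟩
          C z + (Q (n -ℤ z) * Q eB) * g * h
            ≈⟨ +-congˡ (solve 4 (λ y e g h → (y :* e) :* g :* h := y :* (e :* g :* h)) refl (Q (n -ℤ z)) (Q eB) g h) ⟩
          C z + Q (n -ℤ z) * B z ∎
          where
          eA′ = exponent (+ suc N) (+ suc M) j n z
          eB = exponent (+ N) (+ M) j n z
          g = G M (j -ℤ z)
          h = G K z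
          same-exponent : ∀ m N j n z → exponent (+ 1 +ℤ N) (+ 1 +ℤ m) j n z ≡ exponent N m (j -ℤ + 1) (n -ℤ + 1) z
          same-exponent = solve-∀
          split : ∀ m N j n z → exponent (+ 1 +ℤ N) (+ 1 +ℤ m) j n z +ℤ (j -ℤ z) ≡ (n -ℤ z) +ℤ exponent N m j n z
          split = solve-∀
          index : ∀ j z → (j -ℤ z) -ℤ + 1 ≡ (j -ℤ + 1) -ℤ z
          index = solve-∀

        C-B-ratio : ∀ z → (1# - Qs z) * C (z -ℤ + 1)
                          ≈ Q (n -ℤ j) * ((1# - Q ((j -ℤ z) +ℤ + 1)) * B (z -ℤ + 1))
        C-B-ratio z = begin
          (1# - Qs z) * (Q eC * G M ((j -ℤ + 1) -ℤ (z -ℤ + 1)) * h)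
            ≡⟨ ≡.cong (λ i → (1# - Qs z) * (Q eC * G M i * h)) (lower j z) ⟩
          (1# - Qs z) * (Q eC * G M (j -ℤ z) * h)
            ≈⟨ solve 4 (λ s e g h → (con (+ 1) :- s) :* (e :* g :* h) := e :* ((con (+ 1) :- s) :* g) :* h) refl (Qs z) (Q eC) _ h ⟩
          Q eC * ((1# - Qs z) * G M (j -ℤ z)) * h
            ≈⟨ *-congʳ (*-cong (sym (Q-merge (n -ℤ j) eB (split (+ M) (+ N) j n z))) (qbin-ratio M (j -ℤ z))) ⟩
          (Q (n -ℤ j) * Q eB) * ((1# - Q t) * G M t) * h
            ≡⟨ ≡.cong (λ i → (Q (n -ℤ j) * Q eB) * ((1# - Q t) * G M i) * h) (raise j z) ⟩
          (Q (n -ℤ j) * Q eB) * ((1# - Q t) * G M (j -ℤ (z -ℤ + 1))) * h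
            ≈⟨ solve 5 (λ y e s g h → (y :* e) :* ((con (+ 1) :- s) :* g) :* h := y :* ((con (+ 1) :- s) :* (e :* g :* h))) refl (Q (n -ℤ j)) (Q eB) (Q t) _ h ⟩
          Q (n -ℤ j) * ((1# - Q t) * B (z -ℤ + 1)) ∎
          where
          eB = exponent (+ N) (+ M) j n (z -ℤ + 1)
          eC = exponent (+ N) (+ M) (j -ℤ + 1) (n -ℤ + 1) (z -ℤ + 1)
          t = (j -ℤ z) +ℤ + 1
          h = G K (z -ℤ + 1)
          lower : ∀ j z → (j -ℤ + 1) -ℤ (z -ℤ + 1) ≡ j -ℤ z
          lower = solve-∀
          raise : ∀ j z → (j -ℤ z) +ℤ + 1 ≡ j -ℤ (z -ℤ + 1)
          raise = solve-∀
          split : ∀ m N j n z → (n -ℤ j) +ℤ exponent N m j n (z -ℤ + 1) ≡ exponent N m (j -ℤ + 1) (n -ℤ + 1) (z -ℤ + 1)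
          split = solve-∀

        -- ε w is the q-exponent of C w minus that of B (w + 1).
        ε : ℤ → ℤ
        ε w = ((+ N -ℤ + M) -ℤ (w +ℤ w)) +ℤ (j -ℤ n) -ℤ + 1

        C-B-ratio′ : ∀ w → (1# - Q (+ K -ℤ w)) * C w ≈ Q (ε w) * ((1# - Q (w +ℤ + 1)) * B (w +ℤ + 1))
        C-B-ratio′ w = begin
          (1# - Q (+ K -ℤ w)) * (Q eC * g * G K w)
            ≈⟨ solve 4 (λ s e g h → (con (+ 1) :- s) :* (e :* g :* h) := e :* g :* ((con (+ 1) :- s) :* h)) refl (Q (+ K -ℤ w)) (Q eC) g _ ⟩
          Q eC * g * ((1# - Q (+ K -ℤ w)) * G K w)
            ≈⟨ *-cong (*-congʳ (sym (Q-merge (ε w) eB (split (+ M) (+ N) j n w)))) (qbin-ratio K w) ⟩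
          (Q (ε w) * Q eB) * g * ((1# - Q (w +ℤ + 1)) * G K (w +ℤ + 1))
            ≡⟨ ≡.cong (λ i → (Q (ε w) * Q eB) * G M i * ((1# - Q (w +ℤ + 1)) * G K (w +ℤ + 1))) (index j w) ⟩
          (Q (ε w) * Q eB) * G M (j -ℤ (w +ℤ + 1)) * ((1# - Q (w +ℤ + 1)) * G K (w +ℤ + 1))
            ≈⟨ solve 5 (λ x e g s h → (x :* e) :* g :* ((con (+ 1) :- s) :* h) := x :* ((con (+ 1) :- s) :* (e :* g :* h))) refl (Q (ε w)) (Q eB) _ (Q (w +ℤ + 1)) _ ⟩
          Q (ε w) * ((1# - Q (w +ℤ + 1)) * B (w +ℤ + 1)) ∎
          where
          eB = exponent (+ N) (+ M) j n (w +ℤ + 1)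
          eC = exponent (+ N) (+ M) (j -ℤ + 1) (n -ℤ + 1) w
          g = G M ((j -ℤ + 1) -ℤ w)
          split : ∀ m N j n w → (((N -ℤ m) -ℤ (w +ℤ w)) +ℤ (j -ℤ n) -ℤ + 1) +ℤ exponent N m j n (w +ℤ + 1)
                                ≡ exponent N m (j -ℤ + 1) (n -ℤ + 1) w
          split = solve-∀
          index : ∀ j w → (j -ℤ + 1) -ℤ w ≡ j -ℤ (w +ℤ + 1)
          index = solve-∀

        x₀ y₀ : ℤ → ℤ
        x₀ z = (n -ℤ + 1 -ℤ + N) +ℤ ((n -ℤ j) +ℤ ((j -ℤ z) +ℤ + 1))
        y₀ z = (+ 2 *ℤ n -ℤ + 1 -ℤ + N) +ℤ (+ M -ℤ (j -ℤ z))

        C-B-ratio₁ : ∀ z → Q₃ * ((1# - Qs z) * C (z -ℤ + 1)) ≈ (Q₂ - Q (x₀ z)) * B (z -ℤ + 1)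
        C-B-ratio₁ z = begin
          Q₃ * ((1# - Qs z) * C (z -ℤ + 1))
            ≈⟨ *-congˡ (C-B-ratio z) ⟩
          Q₃ * (Q (n -ℤ j) * ((1# - Q t) * B (z -ℤ + 1)))
            ≈⟨ solve 4 (λ x y t b → x :* (y :* ((con (+ 1) :- t) :* b)) := (x :* y :- x :* (y :* t)) :* b) refl Q₃ (Q (n -ℤ j)) (Q t) _ ⟩
          (Q₃ * Q (n -ℤ j) - Q₃ * (Q (n -ℤ j) * Q t)) * B (z -ℤ + 1)
            ≈⟨ *-congʳ (+-cong (Q-merge (n -ℤ + 1 -ℤ + N) (n -ℤ j) (sum (+ N) j n)) (-‿cong (Q-merge₃ (n -ℤ + 1 -ℤ + N) (n -ℤ j) t ≡.refl))) ⟩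
          (Q₂ - Q (x₀ z)) * B (z -ℤ + 1) ∎
          where
          t = (j -ℤ z) +ℤ + 1
          sum : ∀ N j n → (n -ℤ + 1 -ℤ N) +ℤ (n -ℤ j) ≡ + 2 *ℤ n -ℤ + 1 -ℤ N -ℤ j
          sum = solve-∀

        C-B-ratio₂ : ∀ z → Q₃ * ((Q₄ - Q₁ * Qs (z -ℤ + 1)) * C ((z -ℤ + 1) -ℤ + 1)) ≈ (Q₁ - Q (x₀ z)) * B (z -ℤ + 1)
        C-B-ratio₂ z = begin
          Q₃ * ((Q₄ - Q₁ * Qs z₁) * C w)
            ≈⟨ *-congˡ (*-congʳ (+-congʳ (sym (Q-merge₃ (+ 2 *ℤ n -ℤ + 1 -ℤ + N) (+ M -ℤ (j -ℤ z₁)) (+ K -ℤ w) Q₄-sum)))) ⟩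
          Q₃ * ((Q₁ * (Qs z₁ * Q (+ K -ℤ w)) - Q₁ * Qs z₁) * C w)
            ≈⟨ solve 5 (λ x y s k c → x :* ((y :* (s :* k) :- y :* s) :* c) := (:- (x :* (y :* s))) :* ((con (+ 1) :- k) :* c))
                 refl Q₃ Q₁ (Qs z₁) (Q (+ K -ℤ w)) _ ⟩
          (- (Q₃ * (Q₁ * Qs z₁))) * ((1# - Q (+ K -ℤ w)) * C w)
            ≈⟨ *-congˡ (C-B-ratio′ w) ⟩
          (- (Q₃ * (Q₁ * Qs z₁))) * (Q (ε w) * ((1# - Q (w +ℤ + 1)) * B (w +ℤ + 1)))
            ≈⟨ solve 6 (λ x y s e u b → (:- (x :* (y :* s))) :* (e :* ((con (+ 1) :- u) :* b)) := ((x :* ((y :* s) :* e)) :* u :- x :* ((y :* s) :* e)) :* b)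
                 refl Q₃ Q₁ (Qs z₁) (Q (ε w)) (Q (w +ℤ + 1)) _ ⟩
          ((Q₃ * ((Q₁ * Qs z₁) * Q (ε w))) * Q (w +ℤ + 1) - Q₃ * ((Q₁ * Qs z₁) * Q (ε w))) * B (w +ℤ + 1)
            ≈⟨ *-congʳ (+-cong (*-congʳ X-sum) (-‿cong X-sum)) ⟩
          (Q (x₀ z) * Q (w +ℤ + 1) - Q (x₀ z)) * B (w +ℤ + 1)
            ≈⟨ *-congʳ (+-congʳ (Q-merge (x₀ z) (w +ℤ + 1) (Q₁-sum (+ N) j n z))) ⟩
          (Q₁ - Q (x₀ z)) * B (w +ℤ + 1)
            ≡⟨ ≡.cong (λ i → (Q₁ - Q (x₀ z)) * B i) (raise z) ⟩
          (Q₁ - Q (x₀ z)) * B z₁ ∎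
          where
          z₁ = z -ℤ + 1
          w = z₁ -ℤ + 1
          Q₄-sum : (+ 2 *ℤ n -ℤ + 1 -ℤ + N) +ℤ ((+ M -ℤ (j -ℤ z₁)) +ℤ (+ K -ℤ w)) ≡ + 2 *ℤ n -ℤ j
          Q₄-sum = ≡.trans (≡.cong (λ k → (+ 2 *ℤ n -ℤ + 1 -ℤ + N) +ℤ ((+ M -ℤ (j -ℤ z₁)) +ℤ (k -ℤ w))) K≡N-M) (sum (+ M) (+ N) j n z)
            where
            sum : ∀ m N j n z → (+ 2 *ℤ n -ℤ + 1 -ℤ N) +ℤ ((m -ℤ (j -ℤ (z -ℤ + 1))) +ℤ ((N -ℤ m) -ℤ ((z -ℤ + 1) -ℤ + 1)))
                                ≡ + 2 *ℤ n -ℤ j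
            sum = solve-∀
          X-sum : Q₃ * ((Q₁ * Qs z₁) * Q (ε w)) ≈ Q (x₀ z)
          X-sum = begin
            Q₃ * ((Q₁ * Qs z₁) * Q (ε w)) ≈⟨ *-congˡ (*-congʳ (Q-merge (+ 2 *ℤ n -ℤ + 1 -ℤ + N) (+ M -ℤ (j -ℤ z₁)) ≡.refl)) ⟩
            Q₃ * (Q (y₀ z₁) * Q (ε w))    ≈⟨ Q-merge₃ (n -ℤ + 1 -ℤ + N) (y₀ z₁) (ε w) (sum (+ M) (+ N) j n z) ⟩
            Q (x₀ z)                      ∎
            where
            sum : ∀ m N j n z →
              (n -ℤ + 1 -ℤ N) +ℤ (((+ 2 *ℤ n -ℤ + 1 -ℤ N) +ℤ (m -ℤ (j -ℤ (z -ℤ + 1))))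
                +ℤ (((N -ℤ m) -ℤ (((z -ℤ + 1) -ℤ + 1) +ℤ ((z -ℤ + 1) -ℤ + 1))) +ℤ (j -ℤ n) -ℤ + 1))
              ≡ (n -ℤ + 1 -ℤ N) +ℤ ((n -ℤ j) +ℤ ((j -ℤ z) +ℤ + 1))
            sum = solve-∀
          Q₁-sum : ∀ N j n z → ((n -ℤ + 1 -ℤ N) +ℤ ((n -ℤ j) +ℤ ((j -ℤ z) +ℤ + 1))) +ℤ (((z -ℤ + 1) -ℤ + 1) +ℤ + 1) ≡ + 2 *ℤ n -ℤ + 1 -ℤ N
          Q₁-sum = solve-∀
          raise : ∀ z → ((z -ℤ + 1) -ℤ + 1) +ℤ + 1 ≡ z -ℤ + 1
          raise = solve-∀

        B-C-ratio₁ : ∀ z → (Q (n -ℤ z) - Q n) * B z ≈ (Q (y₀ z) - Q₄) * C (z -ℤ + 1)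
        B-C-ratio₁ z = begin
          (Q (n -ℤ z) - Q n) * B z
            ≈⟨ *-congʳ (+-cong (sym n-z-sum) (-‿cong (trans (sym (Q-merge (n -ℤ z) z (sum₁ n z))) (*-congʳ (sym n-z-sum))))) ⟩
          (Q (y₀ z) * Q (ε w) - (Q (y₀ z) * Q (ε w)) * Q z) * B z
            ≈⟨ solve 4 (λ y e u b → (y :* e :- (y :* e) :* u) :* b := y :* (e :* ((con (+ 1) :- u) :* b))) refl (Q (y₀ z)) (Q (ε w)) (Q z) _ ⟩
          Q (y₀ z) * (Q (ε w) * ((1# - Q z) * B z))
            ≡⟨ ≡.cong (λ i → Q (y₀ z) * (Q (ε w) * ((1# - Q i) * B i))) (≡.sym (raise z)) ⟩
          Q (y₀ z) * (Q (ε w) * ((1# - Q (w +ℤ + 1)) * B (w +ℤ + 1)))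
            ≈⟨ *-congˡ (C-B-ratio′ w) ⟨
          Q (y₀ z) * ((1# - Q (+ K -ℤ w)) * C w)
            ≈⟨ solve 3 (λ y k c → y :* ((con (+ 1) :- k) :* c) := (y :- y :* k) :* c) refl (Q (y₀ z)) (Q (+ K -ℤ w)) _ ⟩
          (Q (y₀ z) - Q (y₀ z) * Q (+ K -ℤ w)) * C w
            ≈⟨ *-congʳ (+-congˡ (-‿cong (Q-merge (y₀ z) (+ K -ℤ w) Q₄-sum))) ⟩
          (Q (y₀ z) - Q₄) * C w ∎
          where
          w = z -ℤ + 1
          sum₁ : ∀ n z → (n -ℤ z) +ℤ z ≡ n
          sum₁ = solve-∀
          raise : ∀ z → (z -ℤ + 1) +ℤ + 1 ≡ z
          raise = solve-∀
          n-z-sum : Q (y₀ z) * Q (ε w) ≈ Q (n -ℤ z)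
          n-z-sum = Q-merge (y₀ z) (ε w) (sum (+ M) (+ N) j n z)
            where
            sum : ∀ m N j n z → ((+ 2 *ℤ n -ℤ + 1 -ℤ N) +ℤ (m -ℤ (j -ℤ z)))
                                +ℤ (((N -ℤ m) -ℤ ((z -ℤ + 1) +ℤ (z -ℤ + 1))) +ℤ (j -ℤ n) -ℤ + 1) ≡ n -ℤ z
            sum = solve-∀
          Q₄-sum : y₀ z +ℤ (+ K -ℤ w) ≡ + 2 *ℤ n -ℤ j
          Q₄-sum = ≡.trans (≡.cong (λ k → y₀ z +ℤ (k -ℤ w)) K≡N-M) (sum (+ M) (+ N) j n z)
            where
            sum : ∀ m N j n z → ((+ 2 *ℤ n -ℤ + 1 -ℤ N) +ℤ (m -ℤ (j -ℤ z))) +ℤ ((N -ℤ m) -ℤ (z -ℤ + 1)) ≡ + 2 *ℤ n -ℤ j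
            sum = solve-∀

        B-C-ratio₂ : ∀ z → (Q (y₀ z) - Q₁) * C (z -ℤ + 1) ≈ (Q₁ * Q (n -ℤ (z -ℤ + 1)) - Q n * Q₂) * B (z -ℤ + 1)
        B-C-ratio₂ z = begin
          (Q (y₀ z) - Q₁) * C (z -ℤ + 1)
            ≈⟨ *-congʳ (+-congʳ (sym (Q-merge (+ 2 *ℤ n -ℤ + 1 -ℤ + N) (+ M -ℤ (j -ℤ z)) ≡.refl))) ⟩
          (Q₁ * Qs z - Q₁) * C (z -ℤ + 1)
            ≈⟨ solve 3 (λ y s c → (y :* s :- y) :* c := (:- y) :* ((con (+ 1) :- s) :* c)) refl Q₁ (Qs z) _ ⟩
          (- Q₁) * ((1# - Qs z) * C (z -ℤ + 1))
            ≈⟨ *-congˡ (C-B-ratio z) ⟩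
          (- Q₁) * (Q (n -ℤ j) * ((1# - Q t) * B (z -ℤ + 1)))
            ≈⟨ solve 4 (λ y r t b → (:- y) :* (r :* ((con (+ 1) :- t) :* b)) := (y :* (r :* t) :- y :* r) :* b) refl Q₁ (Q (n -ℤ j)) (Q t) _ ⟩
          (Q₁ * (Q (n -ℤ j) * Q t) - Q₁ * Q (n -ℤ j)) * B (z -ℤ + 1)
            ≈⟨ *-congʳ (+-cong (*-congˡ (Q-merge (n -ℤ j) t (sum₁ j n z)))
                               (-‿cong (Q-regroup (+ 2 *ℤ n -ℤ + 1 -ℤ + N) (n -ℤ j) n (+ 2 *ℤ n -ℤ + 1 -ℤ + N -ℤ j) (sum₂ (+ N) j n)))) ⟩
          (Q₁ * Q (n -ℤ (z -ℤ + 1)) - Q n * Q₂) * B (z -ℤ + 1) ∎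
          where
          t = (j -ℤ z) +ℤ + 1
          sum₁ : ∀ j n z → (n -ℤ j) +ℤ ((j -ℤ z) +ℤ + 1) ≡ n -ℤ (z -ℤ + 1)
          sum₁ = solve-∀
          sum₂ : ∀ N j n → (+ 2 *ℤ n -ℤ + 1 -ℤ N) +ℤ (n -ℤ j) ≡ n +ℤ (+ 2 *ℤ n -ℤ + 1 -ℤ N -ℤ j)
          sum₂ = solve-∀

        A-recurrence : ∀ z → A z - Q₁ * A (z -ℤ + 1)
                             ≈ (B z - Q₂ * B (z -ℤ + 1)) + Q₃ * (C (z -ℤ + 1) - Q₄ * C ((z -ℤ + 1) -ℤ + 1))
        A-recurrence z = begin
          A z - Q₁ * A z₁
            ≈⟨ +-cong (A-pascal z) (-‿cong (*-congˡ (A-pascal z₁))) ⟩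
          (B z + Q₃ * (Qs z * C z₁)) - Q₁ * (B z₁ + Q₃ * (Qs z₁ * C z₂))
            ≈⟨ solve 10 (λ b b₁ c₁ c₂ q₁ q₂ q₃ q₄ s s₁ →
                   (b :+ q₃ :* (s :* c₁)) :- q₁ :* (b₁ :+ q₃ :* (s₁ :* c₂))
                   := ((b :- q₂ :* b₁) :+ q₃ :* (c₁ :- q₄ :* c₂))
                      :+ (((q₂ :- q₁) :* b₁ :- q₃ :* ((con (+ 1) :- s) :* c₁)) :+ q₃ :* ((q₄ :- q₁ :* s₁) :* c₂)))
                 refl (B z) (B z₁) (C z₁) (C z₂) Q₁ Q₂ Q₃ Q₄ (Qs z) (Qs z₁) ⟩
          T + (((Q₂ - Q₁) * B z₁ - Q₃ * ((1# - Qs z) * C z₁)) + Q₃ * ((Q₄ - Q₁ * Qs z₁) * C z₂))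
            ≈⟨ +-congˡ (+-cong (+-congˡ (-‿cong (C-B-ratio₁ z))) (C-B-ratio₂ z)) ⟩
          T + (((Q₂ - Q₁) * B z₁ - (Q₂ - Q (x₀ z)) * B z₁) + (Q₁ - Q (x₀ z)) * B z₁)
            ≈⟨ solve 5 (λ t q₁ q₂ x b → t :+ (((q₂ :- q₁) :* b :- (q₂ :- x) :* b) :+ (q₁ :- x) :* b) := t) refl T Q₁ Q₂ (Q (x₀ z)) (B z₁) ⟩
          T ∎
          where
          z₁ = z -ℤ + 1
          z₂ = z₁ -ℤ + 1
          T = (B z - Q₂ * B z₁) + Q₃ * (C z₁ - Q₄ * C z₂)

        A′-recurrence : ∀ z → A′ z - Q₁ * A′ (z -ℤ + 1)
                              ≈ Q n * (B z - Q₂ * B (z -ℤ + 1)) + (C z - Q₄ * C (z -ℤ + 1))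
        A′-recurrence z = begin
          A′ z - Q₁ * A′ z₁
            ≈⟨ +-cong (A′-pascal z) (-‿cong (*-congˡ (A′-pascal z₁))) ⟩
          (C z + Q (n -ℤ z) * B z) - Q₁ * (C z₁ + Q (n -ℤ z₁) * B z₁)
            ≈⟨ solve 10 (λ b b₁ c c₁ q₁ q₂ q₄ qₙ r r₁ →
                   (c :+ r :* b) :- q₁ :* (c₁ :+ r₁ :* b₁)
                   := (qₙ :* (b :- q₂ :* b₁) :+ (c :- q₄ :* c₁))
                      :+ (((r :- qₙ) :* b :+ (q₄ :- q₁) :* c₁) :- (q₁ :* r₁ :- qₙ :* q₂) :* b₁))
                 refl (B z) (B z₁) (C z) (C z₁) Q₁ Q₂ Q₄ (Q n) (Q (n -ℤ z)) (Q (n -ℤ z₁)) ⟩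
          T + (((Q (n -ℤ z) - Q n) * B z + (Q₄ - Q₁) * C z₁) - W * B z₁)
            ≈⟨ +-congˡ (+-congʳ (+-congʳ (B-C-ratio₁ z))) ⟩
          T + (((Q (y₀ z) - Q₄) * C z₁ + (Q₄ - Q₁) * C z₁) - W * B z₁)
            ≈⟨ +-congˡ (+-congʳ (solve 4 (λ y q₄ q₁ c → (y :- q₄) :* c :+ (q₄ :- q₁) :* c := (y :- q₁) :* c) refl (Q (y₀ z)) Q₄ Q₁ (C z₁))) ⟩
          T + ((Q (y₀ z) - Q₁) * C z₁ - W * B z₁)
            ≈⟨ +-congˡ (+-congʳ (B-C-ratio₂ z)) ⟩
          T + (W * B z₁ - W * B z₁)
            ≈⟨ trans (+-congˡ (-‿inverseʳ _)) (+-identityʳ T) ⟩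
          T ∎
          where
          z₁ = z -ℤ + 1
          T = Q n * (B z - Q₂ * B z₁) + (C z - Q₄ * C z₁)
          W = Q₁ * Q (n -ℤ z₁) - Q n * Q₂

        -- All coefficient sequences here vanish beyond N + 1, so one truncation length serves every series.
        L : ℕ
        L = suc (suc (suc N))

        private
          beyond : ∀ N′ j′ n′ M′ {u} → N′ < u → coef N′ j′ n′ M′ (+ u) ≈ 0#
          beyond N′ j′ n′ M′ N′<u = coef-vanish N′ j′ n′ M′ _ (ℕ.≤-<-trans (ℕ.m∸n≤m N′ M′) N′<u)

          N<L : N < suc (suc N)
          N<L = ℕ.m<n⇒m<1+n (ℕ.n<1+n N)

          D : ℤ → Carrier
          D z = C z - Q₄ * C (z -ℤ + 1)

          D₋₁≈0 : D -[1+ 0 ] ≈ 0#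
          D₋₁≈0 = trans (+-cong (coef-negative N (j -ℤ + 1) (n -ℤ + 1) M 0) (-‿cong (trans (*-congˡ (coef-negative N (j -ℤ + 1) (n -ℤ + 1) M 1)) (zeroʳ _))))
                        (trans (+-congˡ -0#≈0#) (+-identityʳ 0#))

          Dₗ≈0 : D (+ suc (suc N)) ≈ 0#
          Dₗ≈0 = trans (+-cong (beyond N (j -ℤ + 1) (n -ℤ + 1) M N<L) (-‿cong (trans (*-congˡ (beyond N (j -ℤ + 1) (n -ℤ + 1) M (ℕ.n<1+n N))) (zeroʳ _))))
                       (trans (+-congˡ -0#≈0#) (+-identityʳ 0#))

        A-series : (1# - a * Q₁) * series A L ≈ (1# - a * Q₂) * series B L + (a * Q₃) * ((1# - a * Q₄) * series C L)
        A-series = begin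
          (1# - a * Q₁) * series A L
            ≈⟨ series-mul-1-ac A _ Q₁ (coef-negative (suc N) j n M 0) (beyond (suc N) j n M (ℕ.n<1+n (suc N))) ⟩
          series (λ z → A z - Q₁ * A (z -ℤ + 1)) L
            ≈⟨ series-cong L A-recurrence ⟩
          series (λ z → (B z - Q₂ * B (z -ℤ + 1)) + Q₃ * D (z -ℤ + 1)) L
            ≈⟨ series-+ L (λ z → B z - Q₂ * B (z -ℤ + 1)) (λ z → Q₃ * D (z -ℤ + 1)) ⟩
          series (λ z → B z - Q₂ * B (z -ℤ + 1)) L + series (λ z → Q₃ * D (z -ℤ + 1)) L
            ≈⟨ +-cong (sym (series-mul-1-ac B _ Q₂ (coef-negative N j n M 0) (beyond N j n M N<L)))
                      (trans (series-scale L Q₃ (λ z → D (z -ℤ + 1))) (*-congˡ (sym (series-mul-a D _ D₋₁≈0 Dₗ≈0)))) ⟩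
          (1# - a * Q₂) * series B L + Q₃ * (a * series D L)
            ≈⟨ +-congˡ (*-congˡ (*-congˡ (sym (series-mul-1-ac C _ Q₄ (coef-negative N (j -ℤ + 1) (n -ℤ + 1) M 0) (beyond N (j -ℤ + 1) (n -ℤ + 1) M N<L))))) ⟩
          (1# - a * Q₂) * series B L + Q₃ * (a * ((1# - a * Q₄) * series C L))
            ≈⟨ +-congˡ (trans (sym (*-assoc _ _ _)) (*-congʳ (*-comm Q₃ a))) ⟩
          (1# - a * Q₂) * series B L + (a * Q₃) * ((1# - a * Q₄) * series C L) ∎

        A′-series : (1# - a * Q₁) * series A′ L ≈ Q n * ((1# - a * Q₂) * series B L) + (1# - a * Q₄) * series C L
        A′-series = begin
          (1# - a * Q₁) * series A′ L
            ≈⟨ series-mul-1-ac A′ _ Q₁ (coef-negative (suc N) j n (suc M) 0) (beyond (suc N) j n (suc M) (ℕ.n<1+n (suc N))) ⟩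
          series (λ z → A′ z - Q₁ * A′ (z -ℤ + 1)) L
            ≈⟨ series-cong L A′-recurrence ⟩
          series (λ z → Q n * (B z - Q₂ * B (z -ℤ + 1)) + D z) L
            ≈⟨ trans (series-+ L (λ z → Q n * (B z - Q₂ * B (z -ℤ + 1))) D) (+-congʳ (series-scale L (Q n) (λ z → B z - Q₂ * B (z -ℤ + 1)))) ⟩
          Q n * series (λ z → B z - Q₂ * B (z -ℤ + 1)) L + series D L
            ≈⟨ +-cong (*-congˡ (sym (series-mul-1-ac B _ Q₂ (coef-negative N j n M 0) (beyond N j n M N<L))))
                      (sym (series-mul-1-ac C _ Q₄ (coef-negative N (j -ℤ + 1) (n -ℤ + 1) M 0) (beyond N (j -ℤ + 1) (n -ℤ + 1) M N<L))) ⟩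
          Q n * ((1# - a * Q₂) * series B L) + (1# - a * Q₄) * series C L ∎

        series-step : ∀ l → (1# - a * Q₁) * (series A L - l * series A′ L)
                            ≈ (1# - l * Q n) * (1# - a * Q₂) * series B L + (a * Q₃ - l) * (1# - a * Q₄) * series C L
        series-step l = begin
          (1# - a * Q₁) * (series A L - l * series A′ L)
            ≈⟨ solve 4 (λ e f l g → e :* (f :- l :* g) := e :* f :- l :* (e :* g)) refl (1# - a * Q₁) (series A L) l (series A′ L) ⟩
          (1# - a * Q₁) * series A L - l * ((1# - a * Q₁) * series A′ L)
            ≈⟨ +-cong A-series (-‿cong (*-congˡ A′-series)) ⟩
          (p * FB + (a * Q₃) * (r * FC)) - l * (Q n * (p * FB) + r * FC)
            ≈⟨ solve 8 (λ p b a q₃ r c l qₙ → (p :* b :+ (a :* q₃) :* (r :* c)) :- l :* (qₙ :* (p :* b) :+ r :* c)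
                                             := (con (+ 1) :- l :* qₙ) :* p :* b :+ (a :* q₃ :- l) :* r :* c)
                 refl p FB a Q₃ r FC l (Q n) ⟩
          (1# - l * Q n) * p * FB + (a * Q₃ - l) * r * FC ∎
          where
          p = 1# - a * Q₂
          r = 1# - a * Q₄
          FB = series B L
          FC = series C L

      fpoly-recurrence : ∀ N j n (b : Vec Carrier (suc N)) →
        (1# - a * Q (+ 2 *ℤ n -ℤ + 1 -ℤ + N)) * fpoly R a q qinv (suc N) j n b
        ≈ (1# - last b * Q n) * (1# - a * Q (+ 2 *ℤ n -ℤ + 1 -ℤ + N -ℤ j)) * fpoly R a q qinv N j n (init b)
          + (a * Q (n -ℤ + 1 -ℤ + N) - last b) * (1# - a * Q (+ 2 *ℤ n -ℤ j)) * fpoly R a q qinv N (j -ℤ + 1) (n -ℤ + 1) (init b)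
      fpoly-recurrence N j n b = begin
        (1# - a * Q₁) * fpoly R a q qinv (suc N) j n b
          ≈⟨ *-congˡ (fpoly-as-series (suc N) j n b L (ℕ.m<n⇒m<1+n (ℕ.n<1+n (suc N)))) ⟩
        (1# - a * Q₁) * sumRange R (suc (suc N)) (λ M → FA M * E M)
          ≈⟨ *-congˡ (summation-by-parts (suc N) FA E E′ l E₀≈E′₀ Eₛ≈E′ₛ) ⟩
        (1# - a * Q₁) * (sumRange R (suc N) (λ M → (FA M - l * FA (suc M)) * E′ M) + FA (suc N) * E′ (suc N))
          ≈⟨ *-congˡ (trans (+-congˡ (trans (*-congˡ E′-top) (zeroʳ _))) (+-identityʳ _)) ⟩
        (1# - a * Q₁) * sumRange R (suc N) (λ M → (FA M - l * FA (suc M)) * E′ M)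
          ≈⟨ sumRange-distribˡ (suc N) (1# - a * Q₁) _ ⟨
        sumRange R (suc N) (λ M → (1# - a * Q₁) * ((FA M - l * FA (suc M)) * E′ M))
          ≈⟨ sumRange-cong (suc N) (λ M M<1+N → step M (ℕ.≤-pred M<1+N)) ⟩
        sumRange R (suc N) (λ M → P₂ * (FB M * E′ M) + P₃ * (FC M * E′ M))
          ≈⟨ sumRange-+ (suc N) _ _ ⟩
        sumRange R (suc N) (λ M → P₂ * (FB M * E′ M)) + sumRange R (suc N) (λ M → P₃ * (FC M * E′ M))
          ≈⟨ +-cong (sumRange-distribˡ (suc N) P₂ _) (sumRange-distribˡ (suc N) P₃ _) ⟩
        P₂ * sumRange R (suc N) (λ M → FB M * E′ M) + P₃ * sumRange R (suc N) (λ M → FC M * E′ M)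
          ≈⟨ +-cong (*-congˡ (fpoly-as-series N j n b′ L N<L)) (*-congˡ (fpoly-as-series N (j -ℤ + 1) (n -ℤ + 1) b′ L N<L)) ⟨
        P₂ * fpoly R a q qinv N j n b′ + P₃ * fpoly R a q qinv N (j -ℤ + 1) (n -ℤ + 1) b′ ∎
        where
        L = suc (suc (suc N))
        N<L = ℕ.m<n⇒m<1+n (ℕ.m<n⇒m<1+n (ℕ.n<1+n N))
        b′ = init b
        l = last b
        Q₁ = Q (+ 2 *ℤ n -ℤ + 1 -ℤ + N)
        P₂ = (1# - l * Q n) * (1# - a * Q (+ 2 *ℤ n -ℤ + 1 -ℤ + N -ℤ j))
        P₃ = (a * Q (n -ℤ + 1 -ℤ + N) - l) * (1# - a * Q (+ 2 *ℤ n -ℤ j))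
        FA FB FC E E′ : ℕ → Carrier
        FA M = series (coef (suc N) j n M) L
        FB M = series (coef N j n M) L
        FC M = series (coef N (j -ℤ + 1) (n -ℤ + 1) M) L
        E M = pow R (- 1#) M * esym R M b
        E′ M = pow R (- 1#) M * esym R M b′

        E₀≈E′₀ : E 0 ≈ E′ 0
        E₀≈E′₀ = *-congˡ (trans (esym-zero b) (sym (esym-zero b′)))

        Eₛ≈E′ₛ : ∀ M → E (suc M) ≈ E′ (suc M) - l * E′ M
        Eₛ≈E′ₛ M = trans (*-congˡ (esym-snoc N b M))
          (solve 4 (λ s e₁ l e₀ → (:- con (+ 1) :* s) :* (e₁ :+ l :* e₀) := (:- con (+ 1) :* s) :* e₁ :- l :* (s :* e₀))
                 refl (pow R (- 1#) M) (esym R (suc M) b′) l (esym R M b′))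

        E′-top : E′ (suc N) ≈ 0#
        E′-top = trans (*-congˡ (esym-vanish b′ (suc N) (ℕ.n<1+n N))) (zeroʳ _)

        step : ∀ M → M ≤ N → (1# - a * Q₁) * ((FA M - l * FA (suc M)) * E′ M) ≈ P₂ * (FB M * E′ M) + P₃ * (FC M * E′ M)
        step M M≤N = begin
          (1# - a * Q₁) * ((FA M - l * FA (suc M)) * E′ M)
            ≈⟨ *-assoc _ _ _ ⟨
          (1# - a * Q₁) * (FA M - l * FA (suc M)) * E′ M
            ≈⟨ *-congʳ (series-step l) ⟩
          (P₂ * FB M + P₃ * FC M) * E′ M
            ≈⟨ solve 5 (λ p b p′ c e → (p :* b :+ p′ :* c) :* e := p :* (b :* e) :+ p′ :* (c :* e)) refl P₂ (FB M) P₃ (FC M) (E′ M) ⟩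
          P₂ * (FB M * E′ M) + P₃ * (FC M * E′ M) ∎
          where open Contiguity N M M≤N j n using (series-step)

proposition3p7 : ∀ {c ℓ} (R : CommutativeRing c ℓ) →
    let open CommutativeRing R in
    (a q qinv : Carrier) → q * qinv ≈ 1# →
    (N : ℕ) (n : ℤ) (b : Vec Carrier (suc N)) (j : ℕ) → j ≤ suc N →
    (1# - a * zpow R q qinv (+ 2 *ℤ n -ℤ + 1 -ℤ + N)) * fpoly R a q qinv (suc N) (+ j) n b
    ≈ (1# - last b * zpow R q qinv n) * (1# - a * zpow R q qinv (+ 2 *ℤ n -ℤ + 1 -ℤ + N -ℤ + j)) * fpoly R a q qinv N (+ j) n (init b)
    + (a * zpow R q qinv (n -ℤ + 1 -ℤ + N) - last b) * (1# - a * zpow R q qinv (+ 2 *ℤ n -ℤ + j)) * fpoly R a q qinv N (+ j -ℤ + 1) (n -ℤ + 1) (init b)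
proposition3p7 R a q qinv q*qinv≈1 N n b j _ =
  -- the recurrence holds for every integer j
  fpoly-recurrence R q qinv q*qinv≈1 a N (+ j) n b
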